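{- Let $n\ge 3$. The number of $3$-nilpotent semigroups of order $n$ up to presentation is $$\sum_{r=1}^{n-2}\left\{ {r^{2}+1 \atop n-r} \right\},$$ and the number of $3$-nilpotent semigroups of order $n$ up to identity (denoted $t_n$) is $$t_n=\sum_{r=1}^{n-2}\left\{ {r^{2}+1 \atop n-r} \right\}\frac{n!}{r!}.$$
   Context: All semigroups are finite. A semigroup $S$ is $3$-nilpotent if it has a zero element $0$, satisfies $xyz=0$ for all $x,y,z\in S$, and there exist $a,b\in S$ with $ab\neq 0$. $\left\{ {a \atop b} \right\}$ denotes the Stirling number of the second kind (number of partitions of an $a$-set into $b$ non-empty blocks; it is $0$ if $b>a$). A partial partition of a set $Y$ into $k$ parts is a family of $k$ pairwise disjoint non-empty subsets of $Y$ (whose union need not be $Y$). "Up to identity" means: the number of binary operations on a fixed $n$-element set making it a $3$-nilpotent semigroup. "Up to presentation" means: the number of pairs $(r,\mathbf P)$ with $r\ge1$ and $\mathbf P$ a partial partition of $\{1,\dots,r\}\times\{1,\dots,r\}$ into $n-r-1\ge 1$ parts (each such $\mathbf P$ presents a $3$-nilpotent semigroup with generating set $\{1,\dots,r\}$, in which $xy=x'y'$ when $(x,y),(x',y')$ lie in a common part, and $xy=0$ when $(x,y)$ lies in no part). -}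

module Defs where

open import Data.Nat using (ℕ; zero; suc; _+_; _*_; _∸_; _≤_; _!; _/_)
open import Data.Nat.Properties using (_!≢0)
open import Data.Bool using (Bool; true)
open import Data.Fin using (Fin)
open import Data.Vec using (Vec; lookup)
open import Data.Vec.Membership.Propositional renaming (_∈_ to _∈ᵥ_)
open import Data.List using (List; length)
open import Data.List.Relation.Unary.Any using (Any)
open import Data.List.Relation.Unary.AllPairs using (AllPairs)
open import Data.Product using (Σ; _×_; _,_; ∃; ∃-syntax)
open import Relation.Binary.PropositionalEquality using (_≡_; _≢_)
open import Relation.Nullary using (¬_)
open import Function.Bundles using (_⇔_)

HasCount : (A : Set) → (A → A → Set) → ℕ → Set
HasCount A _≈_ m =
  Σ (List A) λ xs →
    (length xs ≡ m) ×
    (∀ a → Any (λ b → a ≈ b) xs) ×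
    AllPairs (λ a b → ¬ (a ≈ b)) xs

S : ℕ → ℕ → ℕ
S zero    zero    = 1
S zero    (suc k) = 0
S (suc n) zero    = 0
S (suc n) (suc k) = suc k * S n (suc k) + S n k

sum1 : ℕ → (ℕ → ℕ) → ℕ
sum1 zero    f = 0
sum1 (suc m) f = sum1 m f + f (suc m)

Table : ℕ → Set
Table n = Vec (Vec (Fin n) n) n

mul : ∀ {n} → Table n → Fin n → Fin n → Fin n
mul T x y = lookup (lookup T x) y

IsSemigroup : ∀ {n} → Table n → Set
IsSemigroup {n} T = ∀ (x y z : Fin n) → mul T (mul T x y) z ≡ mul T x (mul T y z)

IsZero : ∀ {n} → Table n → Fin n → Set
IsZero {n} T o = ∀ (x : Fin n) → (mul T o x ≡ o) × (mul T x o ≡ o)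

Is3Nilpotent : ∀ {n} → Table n → Set
Is3Nilpotent {n} T =
  IsSemigroup T ×
  Σ (Fin n) λ o →
    IsZero T o ×
    (∀ (x y z : Fin n) → mul T (mul T x y) z ≡ o) ×
    (Σ (Fin n) λ a → Σ (Fin n) λ b → mul T a b ≢ o)

Block : ℕ → Set
Block r = Vec (Vec Bool r) r

_∈B_ : ∀ {r} → Fin r × Fin r → Block r → Set
(x , y) ∈B B = lookup (lookup B x) y ≡ true

NonEmptyB : ∀ {r} → Block r → Set
NonEmptyB {r} B = Σ (Fin r) λ x → Σ (Fin r) λ y → (x , y) ∈B B

DisjointB : ∀ {r} → Block r → Block r → Set
DisjointB {r} B C = ∀ (p : Fin r × Fin r) → ¬ ((p ∈B B) × (p ∈B C))

PartialPartition : ℕ → ℕ → Set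
PartialPartition r k =
  Σ (Vec (Block r) k) λ v →
    (∀ i → NonEmptyB (lookup v i)) ×
    (∀ i j → i ≢ j → DisjointB (lookup v i) (lookup v j))

_≈PP_ : ∀ {r k} → PartialPartition r k → PartialPartition r k → Set
_≈PP_ {r} (v , _) (w , _) = ∀ (B : Block r) → (B ∈ᵥ v) ⇔ (B ∈ᵥ w)

Presentation : ℕ → Set
Presentation n =
  Σ ℕ λ r → (1 ≤ r) × (1 ≤ n ∸ r ∸ 1) × PartialPartition r (n ∸ r ∸ 1)

data _≈Pres_ {n : ℕ} : Presentation n → Presentation n → Set where
  same : ∀ {r a a′ b b′} {P Q : PartialPartition r (n ∸ r ∸ 1)} →
         P ≈PP Q → (r , a , b , P) ≈Pres (r , a′ , b′ , Q)

presCount : ℕ → ℕ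
presCount n = sum1 (n ∸ 2) λ r → S (r * r + 1) (n ∸ r)

t : ℕ → ℕ
t n = sum1 (n ∸ 2) λ r → S (r * r + 1) (n ∸ r) * (n ! / r !) {{r !≢0}}

-- Everything is graded by r, the number of generators. A 3-nilpotent table T on n elements is
-- determined by its set Z of non-products (the paper's S ∖ S², of size r) and by the map sending
-- the zero and each of the r² products of two elements of Z into the complement of Z; this map is
-- a surjection from a (1 + r²)-set onto the (n - r)-set of products, and conversely every such
-- surjection onto at least two elements defines a 3-nilpotent table with non-products Z. Choosing
-- Z and the surjection gives C(n,r) · (n-r)! · S(r²+1, n-r) = S(r²+1, n-r) · n!/r! tables.
-- A presentation with r generators is a partial partition of the r²-element square into n-r-1
-- parts, and partial partitions of an N-set into k parts number S(N+1, k+1): the recurrence of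
-- Stirling numbers appears by letting a new point lie in no part, join one of the parts, or form a
-- part by itself.

module Submission where

open import Data.Bool using (Bool; true; false; not)
open import Data.Bool.Properties using (¬-not) renaming (_≟_ to _≟ᵇ_)
open import Data.Empty using (⊥-elim)
open import Data.Fin using (Fin; zero; suc; punchIn; punchOut; combine; remQuot)
open import Data.Fin.Properties
  using (any?; ¬Fin0; punchInᵢ≢i; punchIn-injective; punchIn-punchOut; punchOut-cong; punchOut-punchIn; remQuot-combine; combine-remQuot)
  renaming (_≟_ to _≟ᶠ_; suc-injective to suc-injectiveᶠ)
open import Data.Fin.Subset using (Subset; ∣_∣; ∁; ⁅_⁆) renaming (⊥ to ∅)
open import Data.Fin.Subset.Properties using (∣∁p∣≡n∸∣p∣)
open import Data.List as List using (List; []; _∷_; _++_; length; allFin)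
open import Data.List.Membership.Propositional.Properties using (∈-allFin)
open import Data.List.Properties using (length-++; length-map; length-tabulate)
open import Data.List.Relation.Unary.All as All using (All; []; _∷_)
import Data.List.Relation.Unary.All.Properties as All
open import Data.List.Relation.Unary.AllPairs as AllPairs using (AllPairs; []; _∷_)
import Data.List.Relation.Unary.AllPairs.Properties as AllPairs
open import Data.List.Relation.Unary.Any as Any using (Any; here; there)
import Data.List.Relation.Unary.Any.Properties as Any
open import Data.List.Relation.Unary.Unique.Propositional.Properties using (allFin⁺)
open import Data.Nat using (ℕ; zero; suc; _+_; _*_; _∸_; _!; _/_; _≤_; s≤s; z≤n; NonZero)
open import Data.Nat.Combinatorics using (_C_; nCk+nC[k+1]≡[n+1]C[k+1]; nCk≡n!/k![n-k]!; k![n∸k]!∣n!)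
open import Data.Nat.DivMod using (m/n*n≡m; m*n/n≡m)
open import Data.Nat.Properties
  using (≤-trans; ≤-refl; n≤1+n; 1+n≰n; m≤n⇒m<n∨m≡n; ≤-pred; <⇒≤; suc-injective;
         +-comm; +-assoc; +-identityʳ; *-comm; *-assoc; *-zeroʳ; _!≢0; _!*_!≢0; m∸[m∸n]≡n; ∸-monoʳ-≤; m∸n≤m; m∸n≢0⇒n<m)
open import Data.Nat.Solver using (module +-*-Solver)
open import Data.Product using (Σ; _×_; _,_; proj₁; proj₂)
open import Data.Sum using (_⊎_; inj₁; inj₂; [_,_]′)
open import Data.Unit using (⊤; tt)
open import Data.Vec using (Vec; []; _∷_; lookup; tabulate; map; head; tail)
open import Data.Vec.Membership.Propositional using (_∈_)
open import Data.Vec.Membership.Propositional.Properties using (∈-lookup)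
open import Data.Vec.Properties using (lookup∘tabulate; lookup-map; lookup-replicate; ∷-injectiveʳ; ≡-dec)
open import Data.Vec.Relation.Binary.Pointwise.Extensional using (ext; Pointwise-≡⇒≡)
open import Data.Vec.Relation.Unary.Any using (index)
open import Data.Vec.Relation.Unary.Any.Properties using (lookup-index)
open import Function using (_∘_; _on_; case_of_)
open import Function.Bundles using (_⇔_; mk⇔; Equivalence)
open import Function.Construct.Composition using (_⇔-∘_)
open import Function.Construct.Identity using (⇔-id)
open import Relation.Binary.PropositionalEquality using (_≡_; _≢_; refl; sym; trans; cong; cong₂; subst; subst₂; module ≡-Reasoning)
open import Relation.Nullary using (¬_; Dec; yes; no; does)
open import Relation.Nullary.Decidable using (dec-true; dec-false)
open import Defs
  using (HasCount; S; sum1; presCount; t; Table; mul; IsSemigroup; IsZero; Is3Nilpotent;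
         Block; _∈B_; NonEmptyB; DisjointB; PartialPartition; _≈PP_; Presentation; _≈Pres_; same)

lookup-extensionality : ∀ {A : Set} {n} {v w : Vec A n} → (∀ i → lookup v i ≡ lookup w i) → v ≡ w
lookup-extensionality v≗w = Pointwise-≡⇒≡ (ext v≗w)

-- Counting up to an equivalence

module _ {A : Set} (_≈_ : A → A → Set) where

  Distinct : List A → Set
  Distinct = AllPairs (λ a b → ¬ a ≈ b)

  record Enumerates (P : A → Set) (xs : List A) : Set where
    field
      sound    : All P xs
      complete : ∀ a → P a → Any (a ≈_) xs
      distinct : Distinct xs

  Count : (A → Set) → ℕ → Set
  Count P m = Σ (List A) λ xs → length xs ≡ m × Enumerates P xs

open Enumerates

allFin-Count : ∀ n → Count {Fin n} _≡_ (λ _ → ⊤) n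
allFin-Count n = allFin n , length-tabulate _ ,
  record { sound = All.universal _ _ ; complete = λ i _ → ∈-allFin i ; distinct = allFin⁺ n }

module _ {A : Set} {_≈_ : A → A → Set} where

  Count⇒HasCount : ∀ {m} → Count _≈_ (λ _ → ⊤) m → HasCount A _≈_ m
  Count⇒HasCount (xs , len , e) = xs , len , (λ a → complete e a tt) , distinct e

  HasCount⇒Count : ∀ {m} → HasCount A _≈_ m → Count _≈_ (λ _ → ⊤) m
  HasCount⇒Count (xs , len , cover , dist) = xs , len ,
    record { sound = All.universal _ xs ; complete = λ a _ → cover a ; distinct = dist }

  Count⇒HasCountΣ : ∀ {P : A → Set} {m} → Count _≈_ P m → HasCount (Σ A P) (_≈_ on proj₁) m
  Count⇒HasCountΣ {P} (xs , len , e) = All.toList (sound e) , trans (length-toList (sound e)) len ,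
    (λ (a , p) → cover (complete e a p) (sound e)) , distinct′ (distinct e) (sound e)
    where
    length-toList : ∀ {ys} (ps : All P ys) → length (All.toList ps) ≡ length ys
    length-toList [] = refl
    length-toList (p ∷ ps) = cong suc (length-toList ps)
    cover : ∀ {a ys} → Any (a ≈_) ys → (ps : All P ys) → Any (λ y → a ≈ proj₁ y) (All.toList ps)
    cover (here a≈y) (_ ∷ _) = here a≈y
    cover (there a∈ys) (_ ∷ ps) = there (cover a∈ys ps)
    outside : ∀ {a ys} → All (λ y → ¬ a ≈ y) ys → (ps : All P ys) → All (λ y → ¬ a ≈ proj₁ y) (All.toList ps)
    outside [] [] = []
    outside (a≉y ∷ a≉ys) (_ ∷ ps) = a≉y ∷ outside a≉ys ps
    distinct′ : ∀ {ys} → Distinct _≈_ ys → (ps : All P ys) → AllPairs (λ x y → ¬ proj₁ x ≈ proj₁ y) (All.toList ps)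
    distinct′ [] [] = []
    distinct′ (y≉ys ∷ d) (_ ∷ ps) = outside y≉ys ps ∷ distinct′ d ps

  Count-resp : ∀ {P Q : A → Set} {m} → (∀ {a} → P a → Q a) → (∀ {a} → Q a → P a) →
               Count _≈_ P m → Count _≈_ Q m
  Count-resp P⇒Q Q⇒P (xs , len , e) = xs , len ,
    record { sound = All.map P⇒Q (sound e) ; complete = λ a q → complete e a (Q⇒P q) ; distinct = distinct e }

  Count-⊎ : ∀ {P Q : A → Set} {m k} → (∀ {a b} → P a → Q b → ¬ a ≈ b) →
            Count _≈_ P m → Count _≈_ Q k → Count _≈_ (λ a → P a ⊎ Q a) (m + k)
  Count-⊎ P∦Q (xs , lenx , ex) (ys , leny , ey) = xs ++ ys , trans (length-++ xs) (cong₂ _+_ lenx leny) ,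
    record { sound = All.++⁺ (All.map inj₁ (sound ex)) (All.map inj₂ (sound ey))
           ; complete = λ { a (inj₁ p) → Any.++⁺ˡ (complete ex a p) ; a (inj₂ q) → Any.++⁺ʳ xs (complete ey a q) }
           ; distinct = AllPairs.++⁺ (distinct ex) (distinct ey) (All.map (λ p → All.map (P∦Q p) (sound ey)) (sound ex)) }

  Count-image : ∀ {B : Set} {_≈ᴮ_ : B → B → Set} {Pᴮ : B → Set} {P : A → Set} {m} (f : B → A) →
                (∀ {b} → Pᴮ b → P (f b)) →
                (∀ {b b′} → f b ≈ f b′ → b ≈ᴮ b′) →
                (∀ {b b′} → b ≈ᴮ b′ → f b ≈ f b′) →
                (∀ {a a′ a″} → a ≈ a′ → a′ ≈ a″ → a ≈ a″) →
                (∀ a → P a → Σ B λ b → Pᴮ b × a ≈ f b) →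
                Count _≈ᴮ_ Pᴮ m → Count _≈_ P m
  Count-image f P∘f reflect preserve ≈-trans onto (bs , len , e) = List.map f bs , trans (length-map f bs) len ,
    record { sound = All.map⁺ (All.map P∘f (sound e))
           ; complete = λ a p → let (b , pb , a≈fb) = onto a p in
               Any.map⁺ (Any.map (λ b≈b′ → ≈-trans a≈fb (preserve b≈b′)) (complete e b pb))
           ; distinct = AllPairs.map⁺ (AllPairs.map (λ b≉b′ fb≈fb′ → b≉b′ (reflect fb≈fb′)) (distinct e)) }

  Count-fibres : ∀ {K : Set} {_∼_ : K → K → Set} {Q : K → Set} {P : A → Set} {m L} →
    (∀ {k k′} → k ∼ k′ → k′ ∼ k) → (∀ {k k′ k″} → k ∼ k′ → k′ ∼ k″ → k ∼ k″) →
    (key : A → K) → (∀ {a a′} → a ≈ a′ → key a ∼ key a′) → (∀ {a} → P a → Q (key a)) →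
    (∀ k → Q k → Count _≈_ (λ a → P a × key a ∼ k) L) →
    Count _∼_ Q m → Count _≈_ P (m * L)
  Count-fibres {K} {_∼_} {Q} {P} {L = L} ∼-sym ∼-trans key key-resp P⇒Q fibre (ks , len , e) =
    fibres (sound e) , trans (length-fibres (sound e)) (cong (_* L) len) ,
    record { sound = sound-fibres (sound e)
           ; complete = λ a p → complete-fibres (complete e (key a) (P⇒Q p)) (sound e) p
           ; distinct = distinct-fibres (distinct e) (sound e) }
    where
    fibres : ∀ {ks} → All Q ks → List A
    fibres [] = []
    fibres (q ∷ qs) = proj₁ (fibre _ q) ++ fibres qs
    in-fibre : ∀ {k} (q : Q k) → Enumerates _≈_ (λ a → P a × key a ∼ k) (proj₁ (fibre k q))
    in-fibre q = proj₂ (proj₂ (fibre _ q))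
    length-fibres : ∀ {ks} (qs : All Q ks) → length (fibres qs) ≡ length ks * L
    length-fibres [] = refl
    length-fibres (q ∷ qs) = trans (length-++ (proj₁ (fibre _ q))) (cong₂ _+_ (proj₁ (proj₂ (fibre _ q))) (length-fibres qs))
    keyed : ∀ {ks} (qs : All Q ks) → All (λ a → Any (key a ∼_) ks) (fibres qs)
    keyed [] = []
    keyed (q ∷ qs) = All.++⁺ (All.map (λ (_ , a∼k) → here a∼k) (sound (in-fibre q))) (All.map there (keyed qs))
    sound-fibres : ∀ {ks} (qs : All Q ks) → All P (fibres qs)
    sound-fibres [] = []
    sound-fibres (q ∷ qs) = All.++⁺ (All.map proj₁ (sound (in-fibre q))) (sound-fibres qs)
    complete-fibres : ∀ {a ks} → Any (key a ∼_) ks → (qs : All Q ks) → P a → Any (a ≈_) (fibres qs)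
    complete-fibres (here a∼k) (q ∷ qs) p = Any.++⁺ˡ (complete (in-fibre q) _ (p , a∼k))
    complete-fibres (there a∈ks) (q ∷ qs) p = Any.++⁺ʳ (proj₁ (fibre _ q)) (complete-fibres a∈ks qs p)
    apart : ∀ {k ks} → All (λ k′ → ¬ k ∼ k′) ks → ∀ {a b} → key a ∼ k → Any (key b ∼_) ks → ¬ a ≈ b
    apart (k≁k′ ∷ _) a∼k (here b∼k′) a≈b = k≁k′ (∼-trans (∼-sym a∼k) (∼-trans (key-resp a≈b) b∼k′))
    apart (_ ∷ k≁ks) a∼k (there b∈ks) = apart k≁ks a∼k b∈ks
    distinct-fibres : ∀ {ks} → Distinct _∼_ ks → (qs : All Q ks) → Distinct _≈_ (fibres qs)
    distinct-fibres [] [] = []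
    distinct-fibres (k≁ks ∷ d) (q ∷ qs) = AllPairs.++⁺ (distinct (in-fibre q)) (distinct-fibres d qs)
      (All.map (λ (_ , a∼k) → All.map (apart k≁ks a∼k) (keyed qs)) (sound (in-fibre q)))

  Count-graded : ∀ {P : A → Set} {f : ℕ → ℕ} (grade : A → ℕ) → (∀ {a a′} → a ≈ a′ → grade a ≡ grade a′) →
    ∀ m → (∀ r → 1 ≤ r → r ≤ m → Count _≈_ (λ a → P a × grade a ≡ r) (f r)) →
    Count _≈_ (λ a → P a × 1 ≤ grade a × grade a ≤ m) (sum1 m f)
  Count-graded grade resp zero _ = [] , refl ,
    record { sound = [] ; complete = λ { a (_ , 1≤g , g≤0) → ⊥-elim (1+n≰n (≤-trans 1≤g g≤0)) } ; distinct = [] }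
  Count-graded {P} grade resp (suc m) count = Count-resp to from
    (Count-⊎ apart (Count-graded grade resp m (λ r 1≤r r≤m → count r 1≤r (≤-trans r≤m (n≤1+n m))))
                   (count (suc m) (s≤s z≤n) ≤-refl))
    where
    apart : ∀ {a b} → P a × 1 ≤ grade a × grade a ≤ m → P b × grade b ≡ suc m → ¬ a ≈ b
    apart (_ , _ , ga≤m) (_ , gb≡1+m) a≈b = 1+n≰n (subst (_≤ m) (trans (resp a≈b) gb≡1+m) ga≤m)
    to : ∀ {a} → (P a × 1 ≤ grade a × grade a ≤ m) ⊎ (P a × grade a ≡ suc m) → P a × 1 ≤ grade a × grade a ≤ suc m
    to (inj₁ (p , 1≤g , g≤m)) = p , 1≤g , ≤-trans g≤m (n≤1+n m)
    to (inj₂ (p , g≡1+m)) = p , subst (1 ≤_) (sym g≡1+m) (s≤s z≤n) , subst (_≤ suc m) (sym g≡1+m) ≤-refl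
    from : ∀ {a} → P a × 1 ≤ grade a × grade a ≤ suc m → (P a × 1 ≤ grade a × grade a ≤ m) ⊎ (P a × grade a ≡ suc m)
    from (p , 1≤g , g≤1+m) with m≤n⇒m<n∨m≡n g≤1+m
    ... | inj₁ g<1+m = inj₁ (p , 1≤g , ≤-pred g<1+m)
    ... | inj₂ g≡1+m = inj₂ (p , g≡1+m)

-- Subsets of a given size

select : ∀ {n} (p : Subset n) → Fin ∣ p ∣ → Fin n
select (true ∷ p) zero = zero
select (true ∷ p) (suc i) = suc (select p i)
select (false ∷ p) i = suc (select p i)

rank : ∀ {n} (p : Subset n) x → lookup p x ≡ true → Fin ∣ p ∣
rank (true ∷ p) zero _ = zero
rank (true ∷ p) (suc x) x∈p = suc (rank p x x∈p)
rank (false ∷ p) (suc x) x∈p = rank p x x∈p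

select-∈ : ∀ {n} (p : Subset n) i → lookup p (select p i) ≡ true
select-∈ (true ∷ p) zero = refl
select-∈ (true ∷ p) (suc i) = select-∈ p i
select-∈ (false ∷ p) i = select-∈ p i

select-rank : ∀ {n} (p : Subset n) x x∈p → select p (rank p x x∈p) ≡ x
select-rank (true ∷ p) zero _ = refl
select-rank (true ∷ p) (suc x) x∈p = cong suc (select-rank p x x∈p)
select-rank (false ∷ p) (suc x) x∈p = cong suc (select-rank p x x∈p)

rank-select : ∀ {n} (p : Subset n) i i∈p → rank p (select p i) i∈p ≡ i
rank-select (true ∷ p) zero _ = refl
rank-select (true ∷ p) (suc i) i∈p = cong suc (rank-select p i i∈p)
rank-select (false ∷ p) i i∈p = rank-select p i i∈p

select-injective : ∀ {n} (p : Subset n) {i j} → select p i ≡ select p j → i ≡ j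
select-injective (true ∷ p) {zero} {zero} _ = refl
select-injective (true ∷ p) {suc i} {suc j} e = cong suc (select-injective p (suc-injectiveᶠ e))
select-injective (false ∷ p) e = select-injective p (suc-injectiveᶠ e)

subsets-Count : ∀ n r → Count _≡_ (λ (p : Subset n) → ∣ p ∣ ≡ r) (n C r)
subsets-Count zero zero = ([] ∷ []) , refl ,
  record { sound = refl ∷ [] ; complete = λ { [] _ → here refl } ; distinct = [] ∷ [] }
subsets-Count zero (suc r) = [] , refl , record { sound = [] ; complete = λ { [] () } ; distinct = [] }
subsets-Count (suc n) zero = Count-image (false ∷_) (λ e → e) (cong tail) (cong (false ∷_)) trans onto (subsets-Count n zero)
  where
  onto : ∀ (p : Subset (suc n)) → ∣ p ∣ ≡ 0 → Σ (Subset n) λ q → ∣ q ∣ ≡ 0 × p ≡ false ∷ q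
  onto (false ∷ p) e = p , e , refl
subsets-Count (suc n) (suc r) = subst (Count _≡_ (λ p → ∣ p ∣ ≡ suc r)) (nCk+nC[k+1]≡[n+1]C[k+1] n r)
  (Count-resp (λ {p} → size {p}) (λ {p} → by-head {p}) (Count-⊎ (λ {p q} → apart {p} {q})
    (Count-image (true ∷_) (λ e → refl , cong suc e) (cong tail) (cong (true ∷_)) trans onto-true (subsets-Count n r))
    (Count-image (false ∷_) (λ e → refl , e) (cong tail) (cong (false ∷_)) trans onto-false (subsets-Count n (suc r)))))
  where
  HasHead : Bool → Subset (suc n) → Set
  HasHead b p = head p ≡ b × ∣ p ∣ ≡ suc r
  apart : ∀ {p q} → HasHead true p → HasHead false q → p ≢ q
  apart (hp , _) (hq , _) refl with () ← trans (sym hp) hq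
  onto-true : ∀ p → HasHead true p → Σ (Subset n) λ q → ∣ q ∣ ≡ r × p ≡ true ∷ q
  onto-true (true ∷ q) (_ , e) = q , suc-injective e , refl
  onto-false : ∀ p → HasHead false p → Σ (Subset n) λ q → ∣ q ∣ ≡ suc r × p ≡ false ∷ q
  onto-false (false ∷ q) (_ , e) = q , e , refl
  size : ∀ {p} → HasHead true p ⊎ HasHead false p → ∣ p ∣ ≡ suc r
  size = [ proj₂ , proj₂ ]′
  by-head : ∀ {p} → ∣ p ∣ ≡ suc r → HasHead true p ⊎ HasHead false p
  by-head {true ∷ q} e = inj₁ (refl , e)
  by-head {false ∷ q} e = inj₂ (refl , e)

-- Surjections

Surjective : ∀ {M K} → Vec (Fin K) M → Set
Surjective {M} u = ∀ y → Σ (Fin M) λ i → lookup u i ≡ y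

HeadRepeated HeadFresh : ∀ {M K} → Vec (Fin K) (suc M) → Set
HeadRepeated {M} u = Surjective u × Σ (Fin M) λ i → lookup (tail u) i ≡ head u
HeadFresh u = Surjective u × ∀ i → lookup (tail u) i ≢ head u

head-repeated-Count : ∀ {M K m} (j : Fin K) → Count _≡_ (Surjective {M} {K}) m →
                      Count _≡_ (λ u → HeadRepeated u × head u ≡ j) m
head-repeated-Count {M} {K} j = Count-image (j ∷_) (λ sw → (surj sw , sw j) , refl) ∷-injectiveʳ (cong (j ∷_)) trans
  (λ { (.j ∷ w) ((s , i , wi≡j) , refl) → w , tail-surjective s i wi≡j , refl })
  where
  surj : ∀ {w} → Surjective w → Surjective (j ∷ w)
  surj sw y = let (i , wi≡y) = sw y in suc i , wi≡y
  tail-surjective : ∀ {w : Vec (Fin K) M} → Surjective (j ∷ w) → ∀ i → lookup w i ≡ j → Surjective w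
  tail-surjective s i wi≡j y with j ≟ᶠ y | s y
  ... | yes refl | _ = i , wi≡j
  ... | no j≢y | zero , j≡y = ⊥-elim (j≢y j≡y)
  ... | no _ | suc i′ , wi′≡y = i′ , wi′≡y

-- The fresh head j is removed from the range of the tail by punching it out.
head-fresh-Count : ∀ {M K m} (j : Fin (suc K)) → Count _≡_ (Surjective {M} {K}) m →
                   Count _≡_ (λ u → HeadFresh u × head u ≡ j) m
head-fresh-Count {M} {K} j = Count-image extend (λ {w} sw → (surj sw , fresh {w}) , refl) reflect (cong extend) trans onto
  where
  extend : Vec (Fin K) M → Vec (Fin (suc K)) (suc M)
  extend w = j ∷ map (punchIn j) w
  fresh : ∀ {w} i → lookup (map (punchIn j) w) i ≢ j
  fresh {w} i e = punchInᵢ≢i j (lookup w i) (trans (sym (lookup-map i (punchIn j) w)) e)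
  surj : ∀ {w} → Surjective w → Surjective (extend w)
  surj {w} sw y with j ≟ᶠ y
  ... | yes j≡y = zero , j≡y
  ... | no j≢y = let (i , wi≡y′) = sw (punchOut j≢y) in
    suc i , trans (lookup-map i (punchIn j) w) (trans (cong (punchIn j) wi≡y′) (punchIn-punchOut j≢y))
  reflect : ∀ {w w′} → extend w ≡ extend w′ → w ≡ w′
  reflect {w} {w′} e = lookup-extensionality λ i → punchIn-injective j _ _
    (trans (sym (lookup-map i (punchIn j) w)) (trans (cong (λ v → lookup v i) (∷-injectiveʳ e)) (lookup-map i (punchIn j) w′)))
  onto : ∀ u → HeadFresh u × head u ≡ j → Σ (Vec (Fin K) M) λ w → Surjective w × u ≡ extend w
  onto (.j ∷ w) ((s , fresh-w) , refl) = w′ , surj′ , cong (j ∷_) w≡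
    where
    j≢wi : ∀ i → j ≢ lookup w i
    j≢wi i = fresh-w i ∘ sym
    w′ : Vec (Fin K) M
    w′ = tabulate λ i → punchOut (j≢wi i)
    w≡ : w ≡ map (punchIn j) w′
    w≡ = lookup-extensionality λ i → sym (trans (lookup-map i (punchIn j) w′)
           (trans (cong (punchIn j) (lookup∘tabulate _ i)) (punchIn-punchOut (j≢wi i))))
    surj′ : Surjective w′
    surj′ y with s (punchIn j y)
    ... | zero , j≡ = ⊥-elim (punchInᵢ≢i j y (sym j≡))
    ... | suc i , wi≡ = i , trans (lookup∘tabulate _ i) (trans (punchOut-cong j wi≡) (punchOut-punchIn j))

surjections-Count : ∀ M K → Count _≡_ (Surjective {M} {K}) (K ! * S M K)
surjections-Count zero zero = ([] ∷ []) , refl ,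
  record { sound = (λ ()) ∷ [] ; complete = λ { [] _ → here refl } ; distinct = [] ∷ [] }
surjections-Count zero (suc K) = [] , sym (*-zeroʳ (suc K !)) ,
  record { sound = [] ; complete = λ { [] s → ⊥-elim (¬Fin0 (proj₁ (s zero))) } ; distinct = [] }
surjections-Count (suc M) zero = [] , refl , record { sound = [] ; complete = λ { (() ∷ _) } ; distinct = [] }
surjections-Count (suc M) (suc K) = subst (Count _≡_ Surjective) count-recurrence
  (Count-resp (λ {u} → forget {u}) (λ {u} → by-head {u}) (Count-⊎ (λ {u v} → apart {u} {v})
    (Count-fibres sym trans head (cong head) _ (λ j _ → head-repeated-Count j (surjections-Count M (suc K))) (allFin-Count (suc K)))
    (Count-fibres sym trans head (cong head) _ (λ j _ → head-fresh-Count j (surjections-Count M K)) (allFin-Count (suc K)))))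
  where
  open +-*-Solver
  count-recurrence : suc K * (suc K ! * S M (suc K)) + suc K * (K ! * S M K) ≡ suc K ! * S (suc M) (suc K)
  count-recurrence = solve 4 (λ k f a b → (con 1 :+ k) :* ((con 1 :+ k) :* f :* a) :+ (con 1 :+ k) :* (f :* b)
                                       := ((con 1 :+ k) :* f) :* ((con 1 :+ k) :* a :+ b)) refl K (K !) (S M (suc K)) (S M K)
  apart : ∀ {u v} → HeadRepeated u → HeadFresh v → u ≢ v
  apart (_ , i , e) (_ , fresh) refl = fresh i e
  forget : ∀ {u} → HeadRepeated u ⊎ HeadFresh u → Surjective u
  forget (inj₁ (s , _)) = s
  forget (inj₂ (s , _)) = s
  by-head : ∀ {u} → Surjective u → HeadRepeated u ⊎ HeadFresh u
  by-head {u} s with any? (λ i → lookup (tail u) i ≟ᶠ head u)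
  ... | yes repeated = inj₁ (s , repeated)
  ... | no ¬repeated = inj₂ (s , λ i e → ¬repeated (i , e))

-- Partial partitions

record _≋_ {X : Set} {k} (v w : Vec X k) : Set where
  field
    forth : ∀ i → Σ (Fin k) λ j → lookup w j ≡ lookup v i
    back  : ∀ j → Σ (Fin k) λ i → lookup v i ≡ lookup w j
open _≋_

module _ {X : Set} {k : ℕ} where

  ≋-pointwise : {v w : Vec X k} → (∀ i → lookup v i ≡ lookup w i) → v ≋ w
  ≋-pointwise v≗w = record { forth = λ i → i , sym (v≗w i) ; back = λ i → i , v≗w i }

  ≋-refl : {v : Vec X k} → v ≋ v
  ≋-refl = ≋-pointwise λ _ → refl

  ≋-sym : {v w : Vec X k} → v ≋ w → w ≋ v
  ≋-sym v≋w = record { forth = back v≋w ; back = forth v≋w }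

  ≋-trans : {u v w : Vec X k} → u ≋ v → v ≋ w → u ≋ w
  ≋-trans u≋v v≋w = record
    { forth = λ i → let (j , e) = forth u≋v i ; (m , e′) = forth v≋w j in m , trans e′ e
    ; back = λ m → let (j , e) = back v≋w m ; (i , e′) = back u≋v j in i , trans e′ e }

  ≋-∷ : ∀ (x : X) {v w : Vec X k} → v ≋ w → (x ∷ v) ≋ (x ∷ w)
  ≋-∷ x v≋w = record { forth = λ { zero → zero , refl ; (suc i) → let (j , e) = forth v≋w i in suc j , e }
                     ; back = λ { zero → zero , refl ; (suc j) → let (i , e) = back v≋w j in suc i , e } }

  module _ {Y : Set} (f : X → Y) where

    ≋-map : {v w : Vec X k} → v ≋ w → map f v ≋ map f w
    ≋-map {v} {w} v≋w = record
      { forth = λ i → let (j , e) = forth v≋w i in j , trans (lookup-map j f w) (trans (cong f e) (sym (lookup-map i f v)))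
      ; back = λ j → let (i , e) = back v≋w j in i , trans (lookup-map i f v) (trans (cong f e) (sym (lookup-map j f w))) }

    ≋-map⁻ : (g : Y → X) → (∀ x → g (f x) ≡ x) → {v w : Vec X k} → map f v ≋ map f w → v ≋ w
    ≋-map⁻ g g∘f {v} {w} fv≋fw = record
      { forth = λ i → let (j , e) = forth fv≋fw i in j , cancel w v j i e
      ; back = λ j → let (i , e) = back fv≋fw j in i , cancel v w i j e }
      where
      cancel : ∀ v w i j → lookup (map f v) i ≡ lookup (map f w) j → lookup v i ≡ lookup w j
      cancel v w i j e = trans (sym (g∘f _))
        (trans (cong g (trans (sym (lookup-map i f v)) (trans e (lookup-map j f w)))) (g∘f _))

record NonemptyBlock {N} (b : Subset N) : Set where
  constructor _,_
  field
    point : Fin N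
    point∈ : lookup b point ≡ true
open NonemptyBlock

record Disjoint {N} (b c : Subset N) : Set where
  constructor disjoint
  field separate : ∀ x → ¬ (lookup b x ≡ true × lookup c x ≡ true)
open Disjoint

record IsPartialPartition {N k} (v : Vec (Subset N) k) : Set where
  constructor _,_
  field
    nonempty : ∀ i → NonemptyBlock (lookup v i)
    pairwise-disjoint : ∀ i j → i ≢ j → Disjoint (lookup v i) (lookup v j)
open IsPartialPartition

module _ {N : ℕ} where

  nonempty-∷ : ∀ x {b : Subset N} → NonemptyBlock b → NonemptyBlock (x ∷ b)
  nonempty-∷ _ (y , y∈b) = suc y , y∈b

  disjoint-∷ : ∀ {x y} {b c : Subset N} → ¬ (x ≡ true × y ≡ true) → Disjoint b c → Disjoint (x ∷ b) (y ∷ c)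
  separate (disjoint-∷ x∦y _) zero = x∦y
  separate (disjoint-∷ _ b∦c) (suc z) = separate b∦c z

  disjoint-tail : ∀ {b c : Subset (suc N)} → Disjoint b c → Disjoint (tail b) (tail c)
  separate (disjoint-tail {_ ∷ _} {_ ∷ _} b∦c) z = separate b∦c (suc z)

  disjoint-sym : ∀ {b c : Subset N} → Disjoint b c → Disjoint c b
  separate (disjoint-sym b∦c) z (p , q) = separate b∦c z (q , p)

  ∅-disjoint : ∀ {b : Subset N} → Disjoint ∅ b
  separate ∅-disjoint z (z∈∅ , _) with () ← trans (sym (lookup-replicate z false)) z∈∅

  avoid0 : ∀ {k} → Vec (Subset N) k → Vec (Subset (suc N)) k
  avoid0 v = map (false ∷_) v

  join0 : ∀ {k} → Vec (Subset N) k → Fin k → Vec (Subset (suc N)) k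
  join0 v i = tabulate λ j → does (j ≟ᶠ i) ∷ lookup v j

  single0 : ∀ {k} → Vec (Subset N) k → Vec (Subset (suc N)) (suc k)
  single0 v = ⁅ zero ⁆ ∷ avoid0 v

  strip0 : ∀ {k} → Vec (Subset (suc N)) k → Vec (Subset N) k
  strip0 u = map tail u

  remove0 : ∀ {k} → Vec (Subset (suc N)) (suc k) → Fin (suc k) → Vec (Subset N) k
  remove0 u i = tabulate λ j → tail (lookup u (punchIn i j))

  lookup-avoid0 : ∀ {k} (v : Vec (Subset N) k) i → lookup (avoid0 v) i ≡ false ∷ lookup v i
  lookup-avoid0 v i = lookup-map i (false ∷_) v

  lookup-join0 : ∀ {k} (v : Vec (Subset N) k) i j → lookup (join0 v i) j ≡ does (j ≟ᶠ i) ∷ lookup v j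
  lookup-join0 v i j = lookup∘tabulate _ j

  lookup-strip0 : ∀ {k} (u : Vec (Subset (suc N)) k) i → lookup (strip0 u) i ≡ tail (lookup u i)
  lookup-strip0 u i = lookup-map i tail u

  lookup-remove0 : ∀ {k} (u : Vec (Subset (suc N)) (suc k)) i j → lookup (remove0 u i) j ≡ tail (lookup u (punchIn i j))
  lookup-remove0 u i j = lookup∘tabulate _ j

  does-≟⇒≡ : ∀ {k} {i j : Fin k} → does (j ≟ᶠ i) ≡ true → j ≡ i
  does-≟⇒≡ {i = i} {j} d with j ≟ᶠ i
  ... | yes j≡i = j≡i

  strip0-join0 : ∀ {k} (v : Vec (Subset N) k) i → strip0 (join0 v i) ≡ v
  strip0-join0 v i = lookup-extensionality λ j → trans (lookup-strip0 (join0 v i) j) (cong tail (lookup-join0 v i j))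

  avoid0-isPartialPartition : ∀ {k} {v : Vec (Subset N) k} → IsPartialPartition v → IsPartialPartition (avoid0 v)
  avoid0-isPartialPartition {v = v} pp =
    (λ i → subst NonemptyBlock (sym (lookup-avoid0 v i)) (nonempty-∷ false (nonempty pp i))) ,
    (λ i j i≢j → subst₂ Disjoint (sym (lookup-avoid0 v i)) (sym (lookup-avoid0 v j))
                   (disjoint-∷ (λ { (() , _) }) (pairwise-disjoint pp i j i≢j)))

  join0-isPartialPartition : ∀ {k} {v : Vec (Subset N) k} i → IsPartialPartition v → IsPartialPartition (join0 v i)
  join0-isPartialPartition {v = v} i pp =
    (λ j → subst NonemptyBlock (sym (lookup-join0 v i j)) (nonempty-∷ _ (nonempty pp j))) ,
    (λ j j′ j≢j′ → subst₂ Disjoint (sym (lookup-join0 v i j)) (sym (lookup-join0 v i j′))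
                     (disjoint-∷ (λ (j≡i , j′≡i) → j≢j′ (trans (does-≟⇒≡ j≡i) (sym (does-≟⇒≡ j′≡i))))
                                 (pairwise-disjoint pp j j′ j≢j′)))

  single0-isPartialPartition : ∀ {k} {v : Vec (Subset N) k} → IsPartialPartition v → IsPartialPartition (single0 v)
  single0-isPartialPartition {v = v} pp = nonempty′ , disjoint′
    where
    pp′ : IsPartialPartition (avoid0 v)
    pp′ = avoid0-isPartialPartition pp
    nonempty′ : ∀ i → NonemptyBlock (lookup (single0 v) i)
    nonempty′ zero = zero , refl
    nonempty′ (suc i) = nonempty pp′ i
    disjoint′ : ∀ i j → i ≢ j → Disjoint (lookup (single0 v) i) (lookup (single0 v) j)
    disjoint′ zero zero 0≢0 = ⊥-elim (0≢0 refl)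
    disjoint′ zero (suc j) _ = subst (Disjoint ⁅ zero ⁆) (sym (lookup-avoid0 v j)) (disjoint-∷ (λ { (_ , ()) }) ∅-disjoint)
    disjoint′ (suc i) zero _ = subst (λ b → Disjoint b ⁅ zero ⁆) (sym (lookup-avoid0 v i))
                                (disjoint-∷ (λ { (() , _) }) (disjoint-sym ∅-disjoint))
    disjoint′ (suc i) (suc j) i≢j = pairwise-disjoint pp′ i j (i≢j ∘ cong suc)

  strip0-isPartialPartition : ∀ {k} {u : Vec (Subset (suc N)) k} → IsPartialPartition u →
    (∀ i → NonemptyBlock (tail (lookup u i))) → IsPartialPartition (strip0 u)
  strip0-isPartialPartition {u = u} pp nonempty-tails =
    (λ i → subst NonemptyBlock (sym (lookup-strip0 u i)) (nonempty-tails i)) ,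
    (λ i j i≢j → subst₂ Disjoint (sym (lookup-strip0 u i)) (sym (lookup-strip0 u j)) (disjoint-tail (pairwise-disjoint pp i j i≢j)))

  disjoint⇒≢ : ∀ {b c : Subset N} → Disjoint b c → NonemptyBlock b → b ≢ c
  disjoint⇒≢ b∦c (y , y∈b) refl = separate b∦c y (y∈b , y∈b)

  distinct-blocks : ∀ {k} {v : Vec (Subset N) k} → IsPartialPartition v → ∀ {i j} → i ≢ j → lookup v i ≢ lookup v j
  distinct-blocks pp {i} {j} i≢j = disjoint⇒≢ (pairwise-disjoint pp i j i≢j) (nonempty pp i)

  cons-0∈ : ∀ {b : Subset (suc N)} → lookup b zero ≡ true → b ≡ true ∷ tail b
  cons-0∈ {_ ∷ _} refl = refl

  cons-0∉ : ∀ {b : Subset (suc N)} → lookup b zero ≡ false → b ≡ false ∷ tail b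
  cons-0∉ {_ ∷ _} refl = refl

  nonempty-tail : ∀ {b : Subset (suc N)} → NonemptyBlock b → lookup b zero ≡ false → NonemptyBlock (tail b)
  nonempty-tail {_ ∷ _} (suc y , y∈b) _ = y , y∈b
  nonempty-tail {_ ∷ _} (zero , refl) ()

  nonempty-tail⇒≢⁅0⁆ : ∀ {b : Subset (suc N)} → NonemptyBlock (tail b) → b ≢ ⁅ zero ⁆
  nonempty-tail⇒≢⁅0⁆ (y , y∈) refl with () ← trans (sym (lookup-replicate y false)) y∈

  0∈-unique : ∀ {k} {u : Vec (Subset (suc N)) k} → IsPartialPartition u →
              ∀ {i j} → lookup (lookup u i) zero ≡ true → j ≢ i → lookup (lookup u j) zero ≡ false
  0∈-unique pp {i} {j} 0∈ui j≢i = ¬-not λ 0∈uj → separate (pairwise-disjoint pp i j (j≢i ∘ sym)) zero (0∈ui , 0∈uj)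

  remove0-isPartialPartition : ∀ {k} {u : Vec (Subset (suc N)) (suc k)} {i} → IsPartialPartition u →
    lookup (lookup u i) zero ≡ true → IsPartialPartition (remove0 u i)
  remove0-isPartialPartition {u = u} {i} pp 0∈ui =
    (λ j → subst NonemptyBlock (sym (lookup-remove0 u i j))
             (nonempty-tail (nonempty pp (punchIn i j)) (0∈-unique pp 0∈ui (punchInᵢ≢i i j)))) ,
    (λ j j′ j≢j′ → subst₂ Disjoint (sym (lookup-remove0 u i j)) (sym (lookup-remove0 u i j′))
                     (disjoint-tail (pairwise-disjoint pp _ _ (j≢j′ ∘ punchIn-injective i j j′))))

  single0-≋⁻ : ∀ {k} {v w : Vec (Subset N) k} → single0 v ≋ single0 w → v ≋ w
  single0-≋⁻ {v = v} {w} s = record { forth = shifted s ; back = shifted (≋-sym s) }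
    where
    shifted : ∀ {v w : Vec (Subset N) _} → single0 v ≋ single0 w → ∀ i → Σ _ λ j → lookup w j ≡ lookup v i
    shifted {v} {w} s i with forth s (suc i)
    ... | zero , e with () ← cong (λ b → lookup b zero) (trans e (lookup-avoid0 v i))
    ... | suc j , e = j , cong tail (trans (sym (lookup-avoid0 w j)) (trans e (lookup-avoid0 v i)))

  join0-≋⁻ : ∀ {k} {v : Vec (Subset N) k} → IsPartialPartition v → ∀ {i j} → join0 v i ≋ join0 v j → i ≡ j
  join0-≋⁻ {v = v} pp {i} {j} s with i ≟ᶠ j
  ... | yes i≡j = i≡j
  ... | no i≢j = ⊥-elim (distinct-blocks pp i≢j (trans (sym (cong tail e)) (cong (lookup v) m≡j)))
    where
    m = proj₁ (forth s i)
    e : does (m ≟ᶠ j) ∷ lookup v m ≡ does (i ≟ᶠ i) ∷ lookup v i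
    e = trans (sym (lookup-join0 v j m)) (trans (proj₂ (forth s i)) (lookup-join0 v i i))
    m≡j : m ≡ j
    m≡j = does-≟⇒≡ (trans (cong (λ b → lookup b zero) e) (dec-true (i ≟ᶠ i) refl))

  module _ {k : ℕ} (u : Vec (Subset (suc N)) k) where

    Avoids0 Contains0 Single0 NoSingle0 : Set
    Avoids0 = ∀ i → lookup (lookup u i) zero ≡ false
    Contains0 = Σ (Fin k) λ i → lookup (lookup u i) zero ≡ true
    Single0 = Σ (Fin k) λ i → lookup u i ≡ ⁅ zero ⁆
    NoSingle0 = ∀ i → lookup u i ≢ ⁅ zero ⁆

  avoids-contains-apart : ∀ {k} {u v : Vec (Subset (suc N)) k} → Avoids0 u → Contains0 v → ¬ u ≋ v
  avoids-contains-apart avoids (i , 0∈vi) s with back s i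
  ... | j , uj≡vi with () ← trans (sym (avoids j)) (trans (cong (λ b → lookup b zero) uj≡vi) 0∈vi)

  nosingle-single-apart : ∀ {k} {u v : Vec (Subset (suc N)) k} → NoSingle0 u → Single0 v → ¬ u ≋ v
  nosingle-single-apart nosingle (i , vi≡) s = let (j , uj≡vi) = back s i in nosingle j (trans uj≡vi vi≡)

  avoids-tails : ∀ {k} {u : Vec (Subset (suc N)) k} → IsPartialPartition u → Avoids0 u → ∀ i → NonemptyBlock (tail (lookup u i))
  avoids-tails pp avoids i = nonempty-tail (nonempty pp i) (avoids i)

  joins-tails : ∀ {k} {u : Vec (Subset (suc N)) k} → IsPartialPartition u → Contains0 u → NoSingle0 u →
                ∀ i → NonemptyBlock (tail (lookup u i))
  joins-tails {u = u} pp (i , 0∈ui) nosingle j with j ≟ᶠ i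
  ... | no j≢i = nonempty-tail (nonempty pp j) (0∈-unique pp 0∈ui j≢i)
  ... | yes refl with any? (λ y → lookup (tail (lookup u j)) y ≟ᵇ true)
  ...   | yes (y , y∈) = y , y∈
  ...   | no ∉tail = ⊥-elim (nosingle j (trans (cons-0∈ 0∈ui) (cong (true ∷_) (lookup-extensionality λ y →
                        trans (¬-not λ y∈ → ∉tail (y , y∈)) (sym (lookup-replicate y false))))))

  avoid0-onto : ∀ {k} {u : Vec (Subset (suc N)) k} → Avoids0 u → u ≋ avoid0 (strip0 u)
  avoid0-onto {u = u} avoids = ≋-pointwise λ i →
    trans (cons-0∉ (avoids i)) (sym (trans (lookup-avoid0 (strip0 u) i) (cong (false ∷_) (lookup-strip0 u i))))

  single0-onto : ∀ {k} {u : Vec (Subset (suc N)) (suc k)} {i} → IsPartialPartition u → lookup u i ≡ ⁅ zero ⁆ →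
                 u ≋ single0 (remove0 u i)
  single0-onto {u = u} {i} pp ui≡ = record { forth = forth′ ; back = back′ }
    where
    0∈ui : lookup (lookup u i) zero ≡ true
    0∈ui = cong (λ b → lookup b zero) ui≡
    shifted : ∀ j → lookup u (punchIn i j) ≡ false ∷ lookup (remove0 u i) j
    shifted j = trans (cons-0∉ (0∈-unique pp 0∈ui (punchInᵢ≢i i j))) (cong (false ∷_) (sym (lookup-remove0 u i j)))
    forth′ : ∀ m → Σ _ λ j → lookup (single0 (remove0 u i)) j ≡ lookup u m
    forth′ m with i ≟ᶠ m
    ... | yes refl = zero , sym ui≡
    ... | no i≢m = suc (punchOut i≢m) , trans (lookup-avoid0 (remove0 u i) (punchOut i≢m))
                     (trans (sym (shifted (punchOut i≢m))) (cong (lookup u) (punchIn-punchOut i≢m)))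
    back′ : ∀ j → Σ _ λ m → lookup u m ≡ lookup (single0 (remove0 u i)) j
    back′ zero = i , ui≡
    back′ (suc j) = punchIn i j , trans (shifted j) (sym (lookup-avoid0 (remove0 u i) j))

  join0-onto : ∀ {k} {u : Vec (Subset (suc N)) k} {x : Vec (Subset N) k} {i} →
    IsPartialPartition u → lookup (lookup u i) zero ≡ true → strip0 u ≋ x → IsPartialPartition x →
    Σ (Fin k) λ j → u ≋ join0 x j
  join0-onto {k} {u} {x} {i} pp 0∈ui s ppx = j₀ , record { forth = forth′ ; back = back′ }
    where
    j₀ : Fin k
    j₀ = proj₁ (forth s i)
    xj₀≡ : lookup x j₀ ≡ tail (lookup u i)
    xj₀≡ = trans (proj₂ (forth s i)) (lookup-strip0 u i)
    block-i : lookup (join0 x j₀) j₀ ≡ lookup u i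
    block-i = trans (lookup-join0 x j₀ j₀) (trans (cong₂ _∷_ (dec-true (j₀ ≟ᶠ j₀) refl) xj₀≡) (sym (cons-0∈ 0∈ui)))
    other-block : ∀ {m j} → m ≢ i → j ≢ j₀ → lookup x j ≡ tail (lookup u m) → lookup (join0 x j₀) j ≡ lookup u m
    other-block m≢i j≢j₀ e = trans (lookup-join0 x _ _)
      (trans (cong₂ _∷_ (dec-false (_ ≟ᶠ j₀) j≢j₀) e) (sym (cons-0∉ (0∈-unique pp 0∈ui m≢i))))
    -- The m-th tail is non-empty, as block m misses 0, and disjoint from the i-th tail.
    tails-differ : ∀ {m} → m ≢ i → tail (lookup u m) ≢ tail (lookup u i)
    tails-differ m≢i = disjoint⇒≢ (disjoint-tail (pairwise-disjoint pp _ i m≢i))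
                         (nonempty-tail (nonempty pp _) (0∈-unique pp 0∈ui m≢i))
    forth′ : ∀ m → Σ _ λ j → lookup (join0 x j₀) j ≡ lookup u m
    forth′ m with m ≟ᶠ i
    ... | yes refl = j₀ , block-i
    ... | no m≢i with forth s m
    ...   | j , xj≡ with j ≟ᶠ j₀
    ...     | no j≢j₀ = j , other-block m≢i j≢j₀ (trans xj≡ (lookup-strip0 u m))
    ...     | yes refl = ⊥-elim (tails-differ m≢i (trans (sym (trans xj≡ (lookup-strip0 u m))) xj₀≡))
    back′ : ∀ j → Σ _ λ m → lookup u m ≡ lookup (join0 x j₀) j
    back′ j with j ≟ᶠ j₀
    ... | yes refl = i , sym block-i
    ... | no j≢j₀ with back s j
    ...   | m , um≡ with m ≟ᶠ i
    ...     | no m≢i = m , sym (other-block m≢i j≢j₀ (trans (sym um≡) (lookup-strip0 u m)))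
    ...     | yes refl = ⊥-elim (distinct-blocks ppx (j≢j₀ ∘ sym) (trans xj₀≡ (trans (sym (lookup-strip0 u m)) um≡)))

  avoiding0-Count : ∀ {k m} → Count _≋_ (IsPartialPartition {N} {k}) m →
                   Count _≋_ (λ u → IsPartialPartition u × Avoids0 u) m
  avoiding0-Count = Count-image avoid0
    (λ {v} pp → avoid0-isPartialPartition pp , λ i → cong (λ b → lookup b zero) (lookup-avoid0 v i))
    (≋-map⁻ (false ∷_) tail (λ _ → refl)) (≋-map (false ∷_)) ≋-trans
    (λ u (pp , avoids) → strip0 u , strip0-isPartialPartition pp (avoids-tails pp avoids) , avoid0-onto avoids)

  single0-Count : ∀ {k m} → Count _≋_ (IsPartialPartition {N} {k}) m →
                 Count _≋_ (λ u → IsPartialPartition u × Single0 u) m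
  single0-Count = Count-image single0 (λ pp → single0-isPartialPartition pp , zero , refl)
    single0-≋⁻ (λ s → ≋-∷ ⁅ zero ⁆ (≋-map (false ∷_) s)) ≋-trans
    (λ u (pp , i , ui≡) → remove0 u i , remove0-isPartialPartition pp (cong (λ b → lookup b zero) ui≡) , single0-onto pp ui≡)

  joining0-Count : ∀ {k m} → Count _≋_ (IsPartialPartition {N} {k}) m →
                  Count _≋_ (λ u → IsPartialPartition u × Contains0 u × NoSingle0 u) (m * k)
  joining0-Count {k} = Count-fibres ≋-sym ≋-trans strip0 (≋-map tail)
    (λ (pp , c , ns) → strip0-isPartialPartition pp (joins-tails pp c ns)) fibre
    where
    fibre : ∀ x → IsPartialPartition x →
            Count _≋_ (λ u → (IsPartialPartition u × Contains0 u × NoSingle0 u) × strip0 u ≋ x) k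
    fibre x ppx = Count-image (join0 x) (λ {i} _ → (join0-isPartialPartition i ppx , (i , 0∈) , nosingle) , stripped)
      (join0-≋⁻ ppx) (λ { refl → ≋-refl }) ≋-trans
      (λ u ((pp , (i , 0∈ui) , _) , s) → let (j , u≋) = join0-onto pp 0∈ui s ppx in j , tt , u≋)
      (allFin-Count k)
      where
      0∈ : ∀ {i} → lookup (lookup (join0 x i) i) zero ≡ true
      0∈ {i} = trans (cong (λ b → lookup b zero) (lookup-join0 x i i)) (dec-true (i ≟ᶠ i) refl)
      nosingle : ∀ {i} → NoSingle0 (join0 x i)
      nosingle {i} j = nonempty-tail⇒≢⁅0⁆ (subst NonemptyBlock (cong tail (sym (lookup-join0 x i j))) (nonempty ppx j))
      stripped : ∀ {i} → strip0 (join0 x i) ≋ x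
      stripped {i} = ≋-pointwise λ j → cong (λ v → lookup v j) (strip0-join0 x i)

S-[1+n]-1 : ∀ n → S (suc n) 1 ≡ 1
S-[1+n]-1 zero = refl
S-[1+n]-1 (suc n) = trans (+-identityʳ (S (suc n) 1 + 0)) (trans (+-identityʳ _) (S-[1+n]-1 n))

partialPartitions-Count : ∀ N k → Count _≋_ (IsPartialPartition {N} {k}) (S (suc N) (suc k))
partialPartitions-Count N zero = ([] ∷ []) , sym (S-[1+n]-1 N) ,
  record { sound = ((λ ()) , λ ()) ∷ [] ; complete = λ { [] _ → here ≋-refl } ; distinct = [] ∷ [] }
partialPartitions-Count zero (suc k) = [] , sym (trans (+-identityʳ _) (*-zeroʳ (suc (suc k)))) ,
  record { sound = [] ; complete = λ _ pp → ⊥-elim (¬Fin0 (point (nonempty pp zero))) ; distinct = [] }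
partialPartitions-Count (suc N) (suc k) = subst (Count _≋_ IsPartialPartition) recurrence
  (Count-resp forget classify (Count-⊎ apart-avoids
    (avoiding0-Count (partialPartitions-Count N (suc k)))
    (Count-⊎ apart-single (joining0-Count (partialPartitions-Count N (suc k))) (single0-Count (partialPartitions-Count N k)))))
  where
  a b : ℕ
  a = S (suc N) (suc (suc k))
  b = S (suc N) (suc k)
  recurrence : a + (a * suc k + b) ≡ S (suc (suc N)) (suc (suc k))
  recurrence = trans (sym (+-assoc a (a * suc k) b)) (cong (λ z → a + z + b) (*-comm a (suc k)))
  Avoiding Joining Singling : Vec (Subset (suc N)) (suc k) → Set
  Avoiding u = IsPartialPartition u × Avoids0 u
  Joining u = IsPartialPartition u × Contains0 u × NoSingle0 u
  Singling u = IsPartialPartition u × Single0 u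
  apart-avoids : ∀ {u v} → Avoiding u → Joining v ⊎ Singling v → ¬ u ≋ v
  apart-avoids (_ , avoids) (inj₁ (_ , c , _)) = avoids-contains-apart avoids c
  apart-avoids (_ , avoids) (inj₂ (_ , i , vi≡)) = avoids-contains-apart avoids (i , cong (λ b → lookup b zero) vi≡)
  apart-single : ∀ {u v} → Joining u → Singling v → ¬ u ≋ v
  apart-single (_ , _ , nosingle) (_ , single) = nosingle-single-apart nosingle single
  forget : ∀ {u} → Avoiding u ⊎ (Joining u ⊎ Singling u) → IsPartialPartition u
  forget (inj₁ (pp , _)) = pp
  forget (inj₂ (inj₁ (pp , _))) = pp
  forget (inj₂ (inj₂ (pp , _))) = pp
  classify : ∀ {u} → IsPartialPartition u → Avoiding u ⊎ (Joining u ⊎ Singling u)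
  classify {u} pp with any? (λ i → lookup (lookup u i) zero ≟ᵇ true) | any? (λ i → ≡-dec _≟ᵇ_ (lookup u i) ⁅ zero ⁆)
  ... | no ∌0 | _ = inj₁ (pp , λ i → ¬-not λ 0∈ → ∌0 (i , 0∈))
  ... | yes contains | no ¬single = inj₂ (inj₁ (pp , contains , λ i e → ¬single (i , e)))
  ... | yes _ | yes single = inj₂ (inj₂ (pp , single))

-- Partial partitions of the square {1..r}×{1..r}

SameElements : ∀ {X : Set} {k} → Vec X k → Vec X k → Set
SameElements {X} v w = ∀ (x : X) → (x ∈ v) ⇔ (x ∈ w)

module _ {X : Set} {k : ℕ} where

  ≋⇒SameElements : {v w : Vec X k} → v ≋ w → SameElements v w
  ≋⇒SameElements {v} {w} v≋w x = mk⇔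
    (λ x∈v → let (j , e) = forth v≋w (index x∈v) in subst (_∈ w) (trans e (sym (lookup-index x∈v))) (∈-lookup j w))
    (λ x∈w → let (i , e) = back v≋w (index x∈w) in subst (_∈ v) (trans e (sym (lookup-index x∈w))) (∈-lookup i v))

  SameElements⇒≋ : {v w : Vec X k} → SameElements v w → v ≋ w
  SameElements⇒≋ {v} {w} v≈w = record
    { forth = λ i → let x∈w = Equivalence.to (v≈w (lookup v i)) (∈-lookup i v) in index x∈w , sym (lookup-index x∈w)
    ; back = λ j → let x∈v = Equivalence.from (v≈w (lookup w j)) (∈-lookup j w) in index x∈v , sym (lookup-index x∈v) }

module _ (r : ℕ) where

  flatten : Block r → Subset (r * r)
  flatten B = tabulate λ z → lookup (lookup B (proj₁ (remQuot {r} r z))) (proj₂ (remQuot {r} r z))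

  unflatten : Subset (r * r) → Block r
  unflatten b = tabulate λ x → tabulate λ y → lookup b (combine x y)

  lookup-unflatten : ∀ b x y → lookup (lookup (unflatten b) x) y ≡ lookup b (combine x y)
  lookup-unflatten b x y = trans (cong (λ c → lookup c y) (lookup∘tabulate _ x)) (lookup∘tabulate _ y)

  lookup-flatten : ∀ B x y → lookup (flatten B) (combine x y) ≡ lookup (lookup B x) y
  lookup-flatten B x y = trans (lookup∘tabulate _ (combine x y))
    (cong (λ (x′ , y′) → lookup (lookup B x′) y′) (remQuot-combine x y))

  unflatten-flatten : ∀ B → unflatten (flatten B) ≡ B
  unflatten-flatten B = lookup-extensionality λ x → lookup-extensionality λ y →
    trans (lookup-unflatten (flatten B) x y) (lookup-flatten B x y)

  flatten-unflatten : ∀ b → flatten (unflatten b) ≡ b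
  flatten-unflatten b = lookup-extensionality λ z →
    trans (lookup∘tabulate _ z) (trans (lookup-unflatten b _ _) (cong (lookup b) (combine-remQuot {r} r z)))

  IsPartialPartitionOfSquare : ∀ {k} → Vec (Block r) k → Set
  IsPartialPartitionOfSquare w = (∀ i → NonEmptyB (lookup w i)) × (∀ i j → i ≢ j → DisjointB (lookup w i) (lookup w j))

  unflatten-isPartialPartition : ∀ {k} {v : Vec (Subset (r * r)) k} → IsPartialPartition v →
                                 IsPartialPartitionOfSquare (map unflatten v)
  unflatten-isPartialPartition {v = v} pp =
    (λ i → let (z , z∈) = nonempty pp i ; (x , y) = remQuot {r} r z in x , y ,
       subst (λ B → (x , y) ∈B B) (sym (lookup-map i unflatten v))
         (trans (lookup-unflatten (lookup v i) x y) (trans (cong (lookup (lookup v i)) (combine-remQuot {r} r z)) z∈))) ,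
    (λ i j i≢j (x , y) (p , q) → separate (pairwise-disjoint pp i j i≢j) (combine x y)
       (trans (sym (lookup-unflatten (lookup v i) x y)) (subst (λ B → (x , y) ∈B B) (lookup-map i unflatten v) p) ,
        trans (sym (lookup-unflatten (lookup v j) x y)) (subst (λ B → (x , y) ∈B B) (lookup-map j unflatten v) q)))

  flatten-isPartialPartition : ∀ {k} {w : Vec (Block r) k} → IsPartialPartitionOfSquare w →
                               IsPartialPartition (map flatten w)
  flatten-isPartialPartition {w = w} (nonempty-w , disjoint-w) =
    (λ i → let (x , y , xy∈) = nonempty-w i in combine x y ,
       subst (λ b → lookup b (combine x y) ≡ true) (sym (lookup-map i flatten w)) (trans (lookup-flatten (lookup w i) x y) xy∈)) ,
    (λ i j i≢j → disjoint λ z (p , q) → disjoint-w i j i≢j (remQuot {r} r z)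
       (trans (sym (cell (lookup w i) z)) (subst (λ b → lookup b z ≡ true) (lookup-map i flatten w) p) ,
        trans (sym (cell (lookup w j) z)) (subst (λ b → lookup b z ≡ true) (lookup-map j flatten w) q)))
    where
    cell : ∀ B z → lookup (flatten B) z ≡ lookup (lookup B (proj₁ (remQuot {r} r z))) (proj₂ (remQuot {r} r z))
    cell B z = lookup∘tabulate _ z

partialPartitionsOfSquare-HasCount : ∀ r k → HasCount (PartialPartition r k) _≈PP_ (S (suc (r * r)) (suc k))
partialPartitionsOfSquare-HasCount r k = Count⇒HasCountΣ (Count-image (map (unflatten r))
  (unflatten-isPartialPartition r)
  (λ v≈w → ≋-map⁻ (unflatten r) (flatten r) (flatten-unflatten r) (SameElements⇒≋ v≈w))
  (λ v≋w → ≋⇒SameElements (≋-map (unflatten r) v≋w))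
  (λ s₁ s₂ → ≋⇒SameElements (≋-trans (SameElements⇒≋ s₁) (SameElements⇒≋ s₂)))
  (λ w pp → map (flatten r) w , flatten-isPartialPartition r pp , ≋⇒SameElements (≋-pointwise λ i →
     sym (trans (lookup-map i (unflatten r) (map (flatten r) w))
               (trans (cong (unflatten r) (lookup-map i (flatten r) w)) (unflatten-flatten r (lookup w i))))))
  (partialPartitions-Count (r * r) k))

-- Arithmetic

r≤n∸2⇒2≤n∸r : ∀ {n r} → 2 ≤ n → r ≤ n ∸ 2 → 2 ≤ n ∸ r
r≤n∸2⇒2≤n∸r {n} {r} 2≤n r≤n∸2 = subst (_≤ n ∸ r) (m∸[m∸n]≡n 2≤n) (∸-monoʳ-≤ n r≤n∸2)

sum1-cong : ∀ m {f g : ℕ → ℕ} → (∀ r → r ≤ m → f r ≡ g r) → sum1 m f ≡ sum1 m g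
sum1-cong zero _ = refl
sum1-cong (suc m) f≗g = cong₂ _+_ (sum1-cong m λ r r≤m → f≗g r (≤-trans r≤m (n≤1+n m))) (f≗g (suc m) ≤-refl)

n!/k!≡nCk*[n∸k]! : ∀ {n k} → k ≤ n → (n ! / k !) {{k !≢0}} ≡ (n C k) * (n ∸ k) !
n!/k!≡nCk*[n∸k]! {n} {k} k≤n = begin
  (n ! / k !) {{k !≢0}}                         ≡⟨ cong (λ z → (z / k !) {{k !≢0}}) n!≡ ⟩
  ((n C k) * (n ∸ k) ! * k ! / k !) {{k !≢0}}   ≡⟨ m*n/n≡m ((n C k) * (n ∸ k) !) (k !) {{k !≢0}} ⟩
  (n C k) * (n ∸ k) !                           ∎
  where
  open ≡-Reasoning
  instance
    k!*[n∸k]!≢0 : NonZero (k ! * (n ∸ k) !)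
    k!*[n∸k]!≢0 = k !* (n ∸ k) !≢0
  n!≡ : n ! ≡ (n C k) * (n ∸ k) ! * k !
  n!≡ = begin
    n !                                  ≡⟨ m/n*n≡m (k![n∸k]!∣n! k≤n) ⟨
    n ! / (k ! * (n ∸ k) !) * (k ! * (n ∸ k) !) ≡⟨ cong (_* (k ! * (n ∸ k) !)) (nCk≡n!/k![n-k]! k≤n) ⟨
    (n C k) * (k ! * (n ∸ k) !)          ≡⟨ cong ((n C k) *_) (*-comm (k !) ((n ∸ k) !)) ⟩
    (n C k) * ((n ∸ k) ! * k !)          ≡⟨ *-assoc (n C k) ((n ∸ k) !) (k !) ⟨
    (n C k) * (n ∸ k) ! * k !            ∎

2≤n∸r⇒r≤n∸2 : ∀ {n r} → 2 ≤ n ∸ r → r ≤ n ∸ 2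
2≤n∸r⇒r≤n∸2 {n} {r} 2≤n∸r = subst (_≤ n ∸ 2) (m∸[m∸n]≡n r≤n) (∸-monoʳ-≤ n 2≤n∸r)
  where
  r≤n : r ≤ n
  r≤n = <⇒≤ (m∸n≢0⇒n<m λ n∸r≡0 → case subst (2 ≤_) n∸r≡0 2≤n∸r of λ ())

2≤m⇒1≤m∸1 : ∀ {m} → 2 ≤ m → 1 ≤ m ∸ 1
2≤m⇒1≤m∸1 (s≤s (s≤s _)) = s≤s z≤n

1≤m∸1⇒2≤m : ∀ {m} → 1 ≤ m ∸ 1 → 2 ≤ m
1≤m∸1⇒2≤m {suc (suc _)} _ = s≤s (s≤s z≤n)

2≤m⇒1+[m∸1]≡m : ∀ {m} → 2 ≤ m → suc (m ∸ 1) ≡ m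
2≤m⇒1+[m∸1]≡m (s≤s (s≤s _)) = refl

-- 3-nilpotent multiplication tables

module _ {n : ℕ} where

  lookup-∁ : ∀ (p : Subset n) x → lookup (∁ p) x ≡ not (lookup p x)
  lookup-∁ p x = lookup-map x not p

  ∈∁⇒∉ : ∀ (p : Subset n) x → lookup (∁ p) x ≡ true → lookup p x ≡ false
  ∈∁⇒∉ p x x∈∁p with lookup p x | lookup-∁ p x
  ... | false | _ = refl
  ... | true | e with () ← trans (sym x∈∁p) e

  ∉⇒∈∁ : ∀ (p : Subset n) x → lookup p x ≡ false → lookup (∁ p) x ≡ true
  ∉⇒∈∁ p x x∉p = trans (lookup-∁ p x) (cong not x∉p)

  lookup-table : ∀ (f : Fin n → Fin n → Fin n) x y → mul (tabulate λ x → tabulate λ y → f x y) x y ≡ f x y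
  lookup-table f x y = trans (cong (λ row → lookup row y) (lookup∘tabulate _ x)) (lookup∘tabulate _ y)

  IsProduct : Table n → Fin n → Set
  IsProduct T x = Σ (Fin n) λ a → Σ (Fin n) λ b → mul T a b ≡ x

  isProduct? : ∀ T x → Dec (IsProduct T x)
  isProduct? T x = any? λ a → any? λ b → mul T a b ≟ᶠ x

  -- The paper's S ∖ S², the unique minimal generating set of a 3-nilpotent semigroup.
  nonProducts : Table n → Subset n
  nonProducts T = tabulate λ x → not (does (isProduct? T x))

  lookup-nonProducts : ∀ T x → lookup (nonProducts T) x ≡ not (does (isProduct? T x))
  lookup-nonProducts T x = lookup∘tabulate (λ x → not (does (isProduct? T x))) x

  product⇒∉ : ∀ {T x} → IsProduct T x → lookup (nonProducts T) x ≡ false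
  product⇒∉ {T} {x} prod with isProduct? T x | lookup-nonProducts T x
  ... | yes _ | e = e
  ... | no ¬prod | _ = ⊥-elim (¬prod prod)

  ¬product⇒∈ : ∀ {T x} → ¬ IsProduct T x → lookup (nonProducts T) x ≡ true
  ¬product⇒∈ {T} {x} ¬prod with isProduct? T x | lookup-nonProducts T x
  ... | yes prod | _ = ⊥-elim (¬prod prod)
  ... | no _ | e = e

  ∉⇒product : ∀ {T x} → lookup (nonProducts T) x ≡ false → IsProduct T x
  ∉⇒product {T} {x} x∉ with isProduct? T x | lookup-nonProducts T x
  ... | yes prod | _ = prod
  ... | no _ | e with () ← trans (sym e) x∉

-- g gives, as positions in ∁ p, the zero and the product of every ordered pair of elements of p.
module FromGenerators {n} (p : Subset n) (g : Vec (Fin ∣ ∁ p ∣) (suc (∣ p ∣ * ∣ p ∣))) where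

  zero′ : Fin n
  zero′ = select (∁ p) (lookup g zero)

  product : ∀ x y {bx by} → lookup p x ≡ bx → lookup p y ≡ by → Fin n
  product x y {true} {true} x∈ y∈ = select (∁ p) (lookup g (suc (combine (rank p x x∈) (rank p y y∈))))
  product x y {true} {false} _ _ = zero′
  product x y {false} _ _ = zero′

  _·_ : Fin n → Fin n → Fin n
  x · y = product x y refl refl

  table : Table n
  table = tabulate λ x → tabulate λ y → x · y

  ·-∈∁ : ∀ x y → lookup (∁ p) (x · y) ≡ true
  ·-∈∁ x y = in∁ refl refl
    where
    in∁ : ∀ {bx by} (x∈ : lookup p x ≡ bx) (y∈ : lookup p y ≡ by) → lookup (∁ p) (product x y x∈ y∈) ≡ true
    in∁ {true} {true} _ _ = select-∈ (∁ p) _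
    in∁ {true} {false} _ _ = select-∈ (∁ p) _
    in∁ {false} _ _ = select-∈ (∁ p) _

  ·-∉ˡ : ∀ {x} y → lookup p x ≡ false → x · y ≡ zero′
  ·-∉ˡ {x} y x∉ = absorb refl refl
    where
    absorb : ∀ {bx by} (x∈ : lookup p x ≡ bx) (y∈ : lookup p y ≡ by) → product x y x∈ y∈ ≡ zero′
    absorb {true} x∈ _ with () ← trans (sym x∈) x∉
    absorb {false} _ _ = refl

  ·-∉ʳ : ∀ x {y} → lookup p y ≡ false → x · y ≡ zero′
  ·-∉ʳ x {y} y∉ = absorb refl refl
    where
    absorb : ∀ {bx by} (x∈ : lookup p x ≡ bx) (y∈ : lookup p y ≡ by) → product x y x∈ y∈ ≡ zero′
    absorb {true} {true} _ y∈ with () ← trans (sym y∈) y∉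
    absorb {true} {false} _ _ = refl
    absorb {false} _ _ = refl

  ·-select : ∀ i j → select p i · select p j ≡ select (∁ p) (lookup g (suc (combine i j)))
  ·-select i j = on-p refl refl
    where
    on-p : ∀ {bx by} (i∈ : lookup p (select p i) ≡ bx) (j∈ : lookup p (select p j) ≡ by) →
           product (select p i) (select p j) i∈ j∈ ≡ select (∁ p) (lookup g (suc (combine i j)))
    on-p {true} {true} i∈ j∈ = cong (λ z → select (∁ p) (lookup g (suc z)))
                                    (cong₂ combine (rank-select p i i∈) (rank-select p j j∈))
    on-p {true} {false} _ j∈ with () ← trans (sym (select-∈ p j)) j∈
    on-p {false} i∈ _ with () ← trans (sym (select-∈ p i)) i∈

  mul-table : ∀ x y → mul table x y ≡ x · y
  mul-table = lookup-table _·_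

  ·-remQuot : ∀ k → let (i , j) = remQuot {∣ p ∣} ∣ p ∣ k in select p i · select p j ≡ select (∁ p) (lookup g (suc k))
  ·-remQuot k = trans (·-select _ _) (cong (λ z → select (∁ p) (lookup g (suc z))) (combine-remQuot {∣ p ∣} ∣ p ∣ k))

  mul-table-∈∁ : ∀ x y → lookup (∁ p) (mul table x y) ≡ true
  mul-table-∈∁ x y = subst (λ w → lookup (∁ p) w ≡ true) (sym (mul-table x y)) (·-∈∁ x y)

  [x·y]·z≡zero′ : ∀ x y z → mul table (mul table x y) z ≡ zero′
  [x·y]·z≡zero′ x y z = trans (mul-table _ z) (·-∉ˡ z (∈∁⇒∉ p _ (mul-table-∈∁ x y)))

  x·[y·z]≡zero′ : ∀ x y z → mul table x (mul table y z) ≡ zero′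
  x·[y·z]≡zero′ x y z = trans (mul-table x _) (·-∉ʳ x (∈∁⇒∉ p _ (mul-table-∈∁ y z)))

  zero′∉ : lookup p zero′ ≡ false
  zero′∉ = ∈∁⇒∉ p zero′ (select-∈ (∁ p) _)

  -- Surjectivity of g onto at least two values provides a product different from the zero.
  table-is3Nilpotent : Surjective g → 2 ≤ ∣ ∁ p ∣ → Is3Nilpotent table
  table-is3Nilpotent onto 2≤ =
    (λ x y z → trans ([x·y]·z≡zero′ x y z) (sym (x·[y·z]≡zero′ x y z))) ,
    zero′ ,
    (λ x → trans (mul-table zero′ x) (·-∉ˡ x zero′∉) , trans (mul-table x zero′) (·-∉ʳ x zero′∉)) ,
    [x·y]·z≡zero′ ,
    nonzero-product
    where
    other : ∀ {K} → 2 ≤ K → (u : Fin K) → Σ (Fin K) λ v → v ≢ u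
    other (s≤s (s≤s _)) zero = suc zero , λ ()
    other (s≤s (s≤s _)) (suc u) = zero , λ ()
    nonzero-product : Σ (Fin n) λ a → Σ (Fin n) λ b → mul table a b ≢ zero′
    nonzero-product with other 2≤ (lookup g zero)
    ... | v , v≢g0 with onto v
    ...   | zero , g0≡v = ⊥-elim (v≢g0 (sym g0≡v))
    ...   | suc k , gk≡v = select p (proj₁ (remQuot {∣ p ∣} ∣ p ∣ k)) , select p (proj₂ (remQuot {∣ p ∣} ∣ p ∣ k)) ,
            λ e → v≢g0 (select-injective (∁ p) (trans (cong (select (∁ p)) (sym gk≡v))
                                           (trans (sym (·-remQuot k)) (trans (sym (mul-table _ _)) e))))

  nonProducts-table : Surjective g → nonProducts table ≡ p
  nonProducts-table onto = lookup-extensionality λ x → by-membership x (lookup p x) refl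
    where
    by-membership : ∀ x b → lookup p x ≡ b → lookup (nonProducts table) x ≡ lookup p x
    by-membership x true x∈p = trans (¬product⇒∈ {T = table} {x = x} λ (a , b , ab≡x) →
      case trans (sym (∈∁⇒∉ p x (subst (λ z → lookup (∁ p) z ≡ true) ab≡x (mul-table-∈∁ a b)))) x∈p of λ ()) (sym x∈p)
    by-membership x false x∉p = trans (product⇒∉ {T = table} {x = x} x-product) (sym x∉p)
      where
      u : Fin ∣ ∁ p ∣
      u = rank (∁ p) x (∉⇒∈∁ p x x∉p)
      select-u : select (∁ p) u ≡ x
      select-u = select-rank (∁ p) x (∉⇒∈∁ p x x∉p)
      x-product : IsProduct table x
      x-product with onto u
      ... | zero , g0≡u = x , x , trans (mul-table x x) (trans (·-∉ˡ x x∉p) (trans (cong (select (∁ p)) g0≡u) select-u))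
      ... | suc k , gk≡u = _ , _ , trans (mul-table _ _) (trans (·-remQuot k) (trans (cong (select (∁ p)) gk≡u) select-u))

table-injective : ∀ {n} (p : Subset n) {g g′} → FromGenerators.table p g ≡ FromGenerators.table p g′ → g ≡ g′
table-injective p {g} {g′} tables≡ = lookup-extensionality entry
  where
  module G = FromGenerators p g
  module G′ = FromGenerators p g′
  same-· : ∀ x y → x G.· y ≡ x G′.· y
  same-· x y = trans (sym (G.mul-table x y)) (trans (cong (λ T → mul T x y) tables≡) (G′.mul-table x y))
  entry : ∀ m → lookup g m ≡ lookup g′ m
  entry zero = select-injective (∁ p)
    (trans (sym (G.·-∉ˡ G.zero′ G.zero′∉)) (trans (same-· _ _) (G′.·-∉ˡ G.zero′ G.zero′∉)))
  entry (suc k) = select-injective (∁ p) (trans (sym (G.·-remQuot k)) (trans (same-· _ _) (G′.·-remQuot k)))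

1≤size : ∀ {m} → Fin m → 1 ≤ m
1≤size {suc _} _ = s≤s z≤n

2≤size : ∀ {m} {u v : Fin m} → u ≢ v → 2 ≤ m
2≤size {suc zero} {zero} {zero} 0≢0 = ⊥-elim (0≢0 refl)
2≤size {suc (suc _)} _ = s≤s (s≤s z≤n)

module Normalise {n} (T : Table n) (assoc : IsSemigroup T) (o : Fin n) (o-zero : IsZero T o)
                 (nil : ∀ x y z → mul T (mul T x y) z ≡ o) (a₀ b₀ : Fin n) (a₀b₀≢o : mul T a₀ b₀ ≢ o) where

  Z : Subset n
  Z = nonProducts T

  product-absorbsˡ : ∀ {x} → IsProduct T x → ∀ y → mul T x y ≡ o
  product-absorbsˡ (a , b , ab≡x) y = trans (cong (λ z → mul T z y) (sym ab≡x)) (nil a b y)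

  product-absorbsʳ : ∀ {x} → IsProduct T x → ∀ y → mul T y x ≡ o
  product-absorbsʳ (a , b , ab≡x) y = trans (cong (mul T y) (sym ab≡x)) (trans (sym (assoc y a b)) (nil y a b))

  product∈∁ : ∀ {x} → IsProduct T x → lookup (∁ Z) x ≡ true
  product∈∁ {x} prod = ∉⇒∈∁ Z x (product⇒∉ {T = T} {x = x} prod)

  o-product : IsProduct T o
  o-product = o , o , proj₁ (o-zero o)

  pairProduct : Fin (∣ Z ∣ * ∣ Z ∣) → Fin n
  pairProduct k = mul T (select Z (proj₁ (remQuot {∣ Z ∣} ∣ Z ∣ k))) (select Z (proj₂ (remQuot {∣ Z ∣} ∣ Z ∣ k)))

  generatorCode : Fin (suc (∣ Z ∣ * ∣ Z ∣)) → Fin ∣ ∁ Z ∣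
  generatorCode zero = rank (∁ Z) o (product∈∁ o-product)
  generatorCode (suc k) = rank (∁ Z) (pairProduct k) (product∈∁ (_ , _ , refl))

  g : Vec (Fin ∣ ∁ Z ∣) (suc (∣ Z ∣ * ∣ Z ∣))
  g = tabulate generatorCode

  open FromGenerators Z g

  select-g-zero : select (∁ Z) (lookup g zero) ≡ o
  select-g-zero = trans (cong (select (∁ Z)) (lookup∘tabulate generatorCode zero)) (select-rank (∁ Z) o _)

  select-g-suc : ∀ k → select (∁ Z) (lookup g (suc k)) ≡ pairProduct k
  select-g-suc k = trans (cong (select (∁ Z)) (lookup∘tabulate generatorCode (suc k))) (select-rank (∁ Z) _ _)

  product≡mul : ∀ {x y bx by} (x∈ : lookup Z x ≡ bx) (y∈ : lookup Z y ≡ by) → product x y x∈ y∈ ≡ mul T x y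
  product≡mul {x} {y} {true} {true} x∈ y∈ = trans (select-g-suc (combine (rank Z x x∈) (rank Z y y∈)))
    (trans (cong (λ (i , j) → mul T (select Z i) (select Z j)) (remQuot-combine (rank Z x x∈) (rank Z y y∈)))
           (cong₂ (mul T) (select-rank Z x x∈) (select-rank Z y y∈)))
  product≡mul {x} {y} {true} {false} _ y∉ = trans select-g-zero (sym (product-absorbsʳ (∉⇒product {T = T} {x = y} y∉) x))
  product≡mul {x} {y} {false} x∉ _ = trans select-g-zero (sym (product-absorbsˡ (∉⇒product {T = T} {x = x} x∉) y))

  T≡table : T ≡ table
  T≡table = lookup-extensionality λ x → lookup-extensionality λ y → sym (trans (mul-table x y) (product≡mul refl refl))

  g-surjective : Surjective g
  g-surjective u = by-factors (lookup Z a) (lookup Z b) refl refl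
    where
    x : Fin n
    x = select (∁ Z) u
    x-product : IsProduct T x
    x-product = ∉⇒product {T = T} {x = x} (∈∁⇒∉ Z x (select-∈ (∁ Z) u))
    a b : Fin n
    a = proj₁ x-product
    b = proj₁ (proj₂ x-product)
    ab≡x : mul T a b ≡ x
    ab≡x = proj₂ (proj₂ x-product)
    hit : ∀ m → select (∁ Z) (lookup g m) ≡ x → Σ _ λ m → lookup g m ≡ u
    hit m e = m , select-injective (∁ Z) e
    by-factors : ∀ ba bb → lookup Z a ≡ ba → lookup Z b ≡ bb → Σ _ λ m → lookup g m ≡ u
    by-factors true true a∈ b∈ = hit (suc (combine (rank Z a a∈) (rank Z b b∈))) (trans (product≡mul a∈ b∈) ab≡x)
    by-factors true false _ b∉ = hit zero (trans select-g-zero (trans (sym (product-absorbsʳ (∉⇒product {T = T} {x = b} b∉) a)) ab≡x))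
    by-factors false _ a∉ _ = hit zero (trans select-g-zero (trans (sym (product-absorbsˡ (∉⇒product {T = T} {x = a} a∉) b)) ab≡x))

  a₀∈Z : lookup Z a₀ ≡ true
  a₀∈Z = ¬-not λ a₀∉ → a₀b₀≢o (product-absorbsˡ (∉⇒product {T = T} {x = a₀} a₀∉) b₀)

  1≤∣Z∣ : 1 ≤ ∣ Z ∣
  1≤∣Z∣ = 1≤size (rank Z a₀ a₀∈Z)

  2≤∣∁Z∣ : 2 ≤ ∣ ∁ Z ∣
  2≤∣∁Z∣ = 2≤size {u = rank (∁ Z) o (product∈∁ o-product)}
                  {v = rank (∁ Z) (mul T a₀ b₀) (product∈∁ (a₀ , b₀ , refl))}
    λ e → a₀b₀≢o (sym (trans (sym (select-rank (∁ Z) o _)) (trans (cong (select (∁ Z)) e) (select-rank (∁ Z) _ _))))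

tablesWithGenerators-Count : ∀ {n} (p : Subset n) → 2 ≤ ∣ ∁ p ∣ →
  Count _≡_ (λ T → Is3Nilpotent T × nonProducts T ≡ p) (∣ ∁ p ∣ ! * S (suc (∣ p ∣ * ∣ p ∣)) ∣ ∁ p ∣)
tablesWithGenerators-Count p 2≤ = Count-image (table p)
  (λ onto → table-is3Nilpotent p _ onto 2≤ , nonProducts-table p _ onto)
  (table-injective p) (cong (table p)) trans normalise (surjections-Count _ _)
  where
  open FromGenerators using (table; table-is3Nilpotent; nonProducts-table)
  normalise : ∀ T → Is3Nilpotent T × nonProducts T ≡ p →
              Σ (Vec (Fin ∣ ∁ p ∣) (suc (∣ p ∣ * ∣ p ∣))) λ g → Surjective g × T ≡ table p g
  normalise T ((assoc , o , o-zero , nil , a₀ , b₀ , a₀b₀≢o) , Z≡p) =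
    subst (λ q → Σ (Vec (Fin ∣ ∁ q ∣) (suc (∣ q ∣ * ∣ q ∣))) λ g → Surjective g × T ≡ table q g) Z≡p
          (N.g , N.g-surjective , N.T≡table)
    where module N = Normalise T assoc o o-zero nil a₀ b₀ a₀b₀≢o

tablesOfRank-Count : ∀ {n} r → 2 ≤ n → r ≤ n ∸ 2 →
  Count _≡_ (λ (T : Table n) → Is3Nilpotent T × ∣ nonProducts T ∣ ≡ r) ((n C r) * ((n ∸ r) ! * S (suc (r * r)) (n ∸ r)))
tablesOfRank-Count {n} r 2≤n r≤n∸2 =
  Count-fibres sym trans nonProducts (cong nonProducts) proj₂ fibre (subsets-Count n r)
  where
  fibre : ∀ p → ∣ p ∣ ≡ r →
    Count _≡_ (λ T → (Is3Nilpotent T × ∣ nonProducts T ∣ ≡ r) × nonProducts T ≡ p) ((n ∸ r) ! * S (suc (r * r)) (n ∸ r))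
  fibre p ∣p∣≡r = subst (Count _≡_ _) (cong₂ (λ a c → c ! * S (suc (a * a)) c) ∣p∣≡r ∣∁p∣≡n∸r)
    (Count-resp (λ (N3 , Z≡p) → (N3 , trans (cong ∣_∣ Z≡p) ∣p∣≡r) , Z≡p) (λ ((N3 , _) , Z≡p) → N3 , Z≡p)
      (tablesWithGenerators-Count p (subst (2 ≤_) (sym ∣∁p∣≡n∸r) (r≤n∸2⇒2≤n∸r 2≤n r≤n∸2))))
    where
    ∣∁p∣≡n∸r : ∣ ∁ p ∣ ≡ n ∸ r
    ∣∁p∣≡n∸r = trans (∣∁p∣≡n∸∣p∣ p) (cong (n ∸_) ∣p∣≡r)

tables-HasCount : ∀ n → 2 ≤ n → HasCount (Σ (Table n) Is3Nilpotent) (_≡_ on proj₁) (t n)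
tables-HasCount n 2≤n = Count⇒HasCountΣ (subst (Count _≡_ Is3Nilpotent) (sum1-cong (n ∸ 2) term≡)
  (Count-resp proj₁ (λ {T} N3 → N3 , rank-bounds {T} N3)
    (Count-graded (∣_∣ ∘ nonProducts) (cong (∣_∣ ∘ nonProducts)) (n ∸ 2) (λ r _ r≤ → tablesOfRank-Count r 2≤n r≤))))
  where
  rank-bounds : ∀ {T : Table n} → Is3Nilpotent T → 1 ≤ ∣ nonProducts T ∣ × ∣ nonProducts T ∣ ≤ n ∸ 2
  rank-bounds {T} (assoc , o , o-zero , nil , a₀ , b₀ , a₀b₀≢o) =
    N.1≤∣Z∣ , 2≤n∸r⇒r≤n∸2 (subst (2 ≤_) (∣∁p∣≡n∸∣p∣ N.Z) N.2≤∣∁Z∣)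
    where module N = Normalise T assoc o o-zero nil a₀ b₀ a₀b₀≢o
  term≡ : ∀ r → r ≤ n ∸ 2 → (n C r) * ((n ∸ r) ! * S (suc (r * r)) (n ∸ r)) ≡ S (r * r + 1) (n ∸ r) * (n ! / r !) {{r !≢0}}
  term≡ r r≤n∸2 = begin
    (n C r) * ((n ∸ r) ! * S (suc (r * r)) (n ∸ r))  ≡⟨ *-assoc (n C r) ((n ∸ r) !) _ ⟨
    (n C r) * (n ∸ r) ! * S (suc (r * r)) (n ∸ r)    ≡⟨ *-comm _ (S (suc (r * r)) (n ∸ r)) ⟩
    S (suc (r * r)) (n ∸ r) * ((n C r) * (n ∸ r) !)  ≡⟨ cong₂ (λ a b → S a (n ∸ r) * b) (+-comm 1 (r * r))
                                                                (sym (n!/k!≡nCk*[n∸k]! r≤n)) ⟩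
    S (r * r + 1) (n ∸ r) * (n ! / r !) {{r !≢0}}    ∎
    where
    open ≡-Reasoning
    r≤n : r ≤ n
    r≤n = ≤-trans r≤n∸2 (m∸n≤m n 2)

-- Presentations

presentationsOfRank-Count : ∀ {n} r → 2 ≤ n → 1 ≤ r → r ≤ n ∸ 2 →
  Count (_≈Pres_ {n}) (λ x → ⊤ × proj₁ x ≡ r) (S (r * r + 1) (n ∸ r))
presentationsOfRank-Count {n} r 2≤n 1≤r r≤n∸2 =
  subst (Count _≈Pres_ _) (cong₂ S (+-comm 1 (r * r)) (2≤m⇒1+[m∸1]≡m 2≤n∸r))
    (Count-image present (λ _ → tt , refl) (λ { (same P≈Q) → P≈Q }) same ≈Pres-trans
      (λ { (.r , _ , _ , P) (_ , refl) → P , tt , same λ _ → ⇔-id _ })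
      (HasCount⇒Count (partialPartitionsOfSquare-HasCount r (n ∸ r ∸ 1))))
  where
  2≤n∸r : 2 ≤ n ∸ r
  2≤n∸r = r≤n∸2⇒2≤n∸r 2≤n r≤n∸2
  present : PartialPartition r (n ∸ r ∸ 1) → Presentation n
  present P = r , 1≤r , 2≤m⇒1≤m∸1 2≤n∸r , P
  ≈Pres-trans : ∀ {x y z : Presentation n} → x ≈Pres y → y ≈Pres z → x ≈Pres z
  ≈Pres-trans (same P≈Q) (same Q≈R) = same λ B → Q≈R B ⇔-∘ P≈Q B

presentations-HasCount : ∀ n → 2 ≤ n → HasCount (Presentation n) _≈Pres_ (presCount n)
presentations-HasCount n 2≤n = Count⇒HasCount
  (Count-resp (λ _ → tt) (λ {x} _ → tt , rank-bounds x)
    (Count-graded proj₁ (λ { (same _) → refl }) (n ∸ 2) (λ r 1≤r r≤ → presentationsOfRank-Count r 2≤n 1≤r r≤)))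
  where
  rank-bounds : ∀ (x : Presentation n) → 1 ≤ proj₁ x × proj₁ x ≤ n ∸ 2
  rank-bounds (r , 1≤r , 1≤parts , _) = 1≤r , 2≤n∸r⇒r≤n∸2 (1≤m∸1⇒2≤m 1≤parts)

lemma2p2 : (n : ℕ) → 3 ≤ n →
    HasCount (Presentation n) _≈Pres_ (presCount n) ×
    HasCount (Σ (Table n) Is3Nilpotent) (λ T U → proj₁ T ≡ proj₁ U) (t n)
lemma2p2 n 3≤n = presentations-HasCount n 2≤n , tables-HasCount n 2≤n
  where
  2≤n : 2 ≤ n
  2≤n = ≤-trans (n≤1+n 2) 3≤n
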